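{- Let $P$ be an $n$-element poset. The braid relations $(t_it_{i+1})^3=1$ for all $1\le i\le n-2$ hold in $\mathcal{BK}_P$ if and only if $P$ is a disjoint union of chains.
   Context: A linear extension of $P$ is a list $(p_1,\dots,p_n)$ of all elements with $p_a<_P p_b$ implying $a<b$; ${\mathcal{L}}(P)$ is the set of these. The Bender--Knuth move $t_i$ ($1\le i\le n-1$) acts on ${\mathcal{L}}(P)$ by swapping $p_i,p_{i+1}$ if they are incomparable and fixing the list otherwise; $\mathcal{BK}_P$ is the permutation group on ${\mathcal{L}}(P)$ generated by them, and a relation holds if the corresponding permutation is the identity. -}

module Defs where

open import Data.Nat using (ℕ; zero; suc; _<_)
open import Data.Fin using (Fin)
import Data.Fin as F
open import Data.List using (List; []; _∷_; length; lookup)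
open import Data.List.Relation.Unary.Unique.Propositional using (Unique)
open import Data.List.Membership.Propositional using (_∈_)
open import Data.Product using (Σ; _×_)
open import Data.Sum using (_⊎_)
open import Data.Bool using (Bool; true; false; if_then_else_)
open import Function using (_∘_)
open import Relation.Nullary using (¬_; Dec; yes; no)
open import Relation.Binary.Structures using (IsDecPartialOrder)
open import Relation.Binary.PropositionalEquality using (_≡_)

-- An n-element poset, realised (up to isomorphism) on the carrier Fin n,
-- with order relation _≼_ (decidable partial order w.r.t. propositional equality).
module FinPoset {n : ℕ} (_≼_ : Fin n → Fin n → Set)
                (isPO : IsDecPartialOrder _≡_ _≼_) where

  open IsDecPartialOrder isPO using (_≤?_)

  _≺_ : Fin n → Fin n → Set
  x ≺ y = (x ≼ y) × ¬ (x ≡ y)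

  incomparable? : Fin n → Fin n → Bool
  incomparable? x y with x ≤? y | y ≤? x
  ... | no _ | no _ = true
  ... | _    | _    = false

  IsLinearExtension : List (Fin n) → Set
  IsLinearExtension L =
    Unique L × ((x : Fin n) → x ∈ L) ×
    ((a b : Fin (length L)) → lookup L a ≺ lookup L b → a F.< b)

  -- Bender–Knuth move, 0-based: bk i swaps the entries at (0-based) positions
  -- i and i+1 if they are incomparable, and fixes the list otherwise.
  -- Thus the paper's t_i is bk (i - 1).
  bk : ℕ → List (Fin n) → List (Fin n)
  bk zero (x ∷ y ∷ xs) = if incomparable? x y then y ∷ x ∷ xs else x ∷ y ∷ xs
  bk zero xs = xs
  bk (suc i) [] = []
  bk (suc i) (x ∷ xs) = x ∷ bk i xs

  -- The braid relation (t_i t_{i+1})^3 = 1 holds in BK_P (0-based index i),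
  -- i.e. the permutation acts as the identity on every linear extension.
  BraidHolds : ℕ → Set
  BraidHolds i = (L : List (Fin n)) → IsLinearExtension L →
    let s = bk i ∘ bk (suc i) in s (s (s L)) ≡ L

  -- All braid relations (t_i t_{i+1})^3 = 1 for 1 ≤ i ≤ n-2
  -- (0-based: i with i + 2 < n).
  AllBraidsHold : Set
  AllBraidsHold = (i : ℕ) → suc (suc i) < n → BraidHolds i

  IsDisjointUnionOfChains : Set
  IsDisjointUnionOfChains =
    Σ (Fin n → ℕ) λ c →
      ((x y : Fin n) → x ≼ y → c x ≡ c y) ×
      ((x y : Fin n) → c x ≡ c y → (x ≼ y) ⊎ (y ≼ x))

-- Comparability is reflexive and symmetric, and P is a disjoint union of chains exactly when it is
-- also transitive.  The word (t_i t_{i+1})^3 only rearranges the entries in positions i, i+1, i+2.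
-- If comparability is transitive, then none, one or all three pairs among them are comparable, and
-- t_i t_{i+1} acts on their arrangements as the identity or as a 3-cycle, so the relation holds.
-- Conversely, if x ~ y ~ z with x, z incomparable, then y lies below both or above both.  Passing
-- to a maximal common lower bound and two of its covers (or dually) yields an element covered by
-- two incomparable ones (or covering them).  These three can be listed consecutively in a linear
-- extension, after a down-set sorted by rank, and on such a triple t_i t_{i+1} has order 2.

module Submission where

open import Defs

open import Level using (0ℓ)
open import Data.Empty using (⊥)
open import Data.Product using (_×_; _,_; proj₁; proj₂; ∃-syntax)
open import Data.Sum using (_⊎_; inj₁; inj₂; [_,_]′) renaming (swap to ⊎-swap)
open import Function using (_∘_; flip)
open import Function.Bundles using (_⇔_; mk⇔)
open import Relation.Nullary using (¬_; yes; no; contradiction)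
open import Relation.Nullary.Decidable using (_⊎-dec_; _×-dec_; ¬?)
open import Relation.Unary as U using (Pred; ∁; _∪_)
open import Relation.Binary.Core using (Rel)
open import Relation.Binary.Definitions using (Decidable; Transitive)
open import Relation.Binary.Structures using (IsDecPartialOrder)
open import Relation.Binary.PropositionalEquality using (_≡_; _≢_; refl; sym; trans; cong; setoid)
import Relation.Binary.Construct.On as On
import Relation.Binary.Construct.NonStrictToStrict as ToStrict
open import Induction.WellFounded using (WellFounded; Acc; acc)

open import Data.Nat using (ℕ; zero; suc; _<_; _≤_; z≤n; s≤s)
import Data.Nat.Properties as ℕ
open import Data.Nat.Properties using (m≤n⇒m≤1+n)
open import Data.Fin using (Fin; zero; suc; toℕ)
import Data.Fin as F
open import Data.Fin.Properties using (injective⇒≤; any?; toℕ-injective)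
open import Data.Fin.Induction using (po-wellFounded; po-noetherian)

open import Data.List using (List; []; _∷_; length; _++_; filter; lookup; allFin)
open import Data.List.Properties using (∷-injectiveˡ; ∷-injectiveʳ; ++-cancelˡ)
import Data.List.Sort as Sort
open import Data.List.Membership.Propositional using (_∈_)
open import Data.List.Membership.Propositional.Properties
  using (∈-lookup; ∈-allFin; ∈-filter⁺; ∈-++⁺ˡ; ∈-++⁺ʳ)
import Data.List.Membership.DecPropositional as DecMembership
open import Data.List.Relation.Unary.All as All using (All; []; _∷_)
open import Data.List.Relation.Unary.All.Properties using (all-filter) renaming (++⁺ to All-++⁺)
open import Data.List.Relation.Unary.Any as Any using (here; there)
open import Data.List.Relation.Unary.Any.Properties using (lookup-index)
open import Data.List.Relation.Unary.AllPairs as AllPairs using (AllPairs; []; _∷_)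
import Data.List.Relation.Unary.AllPairs.Properties as AllPairsₚ
open import Data.List.Relation.Unary.Unique.Propositional using (Unique)
import Data.List.Relation.Unary.Unique.Propositional.Properties as Unique
open import Data.List.Relation.Unary.Linked.Properties using (Linked⇒AllPairs)
open import Data.List.Relation.Binary.Permutation.Propositional using (↭-sym; ↭⇒↭ₛ)
open import Data.List.Relation.Binary.Permutation.Propositional.Properties using (∈-resp-↭; All-resp-↭)
import Data.List.Relation.Binary.Permutation.Setoid.Properties as PermutationSetoid

module _ {a p q} {A : Set a} {P : Pred A p} {Q : Pred A q} (P? : U.Decidable P) (Q? : U.Decidable Q)
         (P⊆Q : ∀ {x} → P x → Q x) where

  length-filter-mono : ∀ xs → length (filter P? xs) ≤ length (filter Q? xs)
  length-filter-mono []       = z≤n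
  length-filter-mono (x ∷ xs) with P? x | Q? x
  ... | yes _  | yes _  = s≤s (length-filter-mono xs)
  ... | yes px | no ¬qx = contradiction (P⊆Q px) ¬qx
  ... | no _   | yes _  = m≤n⇒m≤1+n (length-filter-mono xs)
  ... | no _   | no _   = length-filter-mono xs

  length-filter-strict : ∀ {t} xs → t ∈ xs → ¬ P t → Q t →
                         length (filter P? xs) < length (filter Q? xs)
  length-filter-strict (x ∷ xs) (here refl) ¬pt qt with P? x | Q? x
  ... | yes pt | _      = contradiction pt ¬pt
  ... | no _   | yes _  = s≤s (length-filter-mono xs)
  ... | no _   | no ¬qt = contradiction qt ¬qt
  length-filter-strict (x ∷ xs) (there t∈xs) ¬pt qt with P? x | Q? x
  ... | yes _  | yes _  = s≤s (length-filter-strict xs t∈xs ¬pt qt)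
  ... | yes px | no ¬qx = contradiction (P⊆Q px) ¬qx
  ... | no _   | yes _  = m≤n⇒m≤1+n (length-filter-strict xs t∈xs ¬pt qt)
  ... | no _   | no _   = length-filter-strict xs t∈xs ¬pt qt

lookup-injective : ∀ {a} {A : Set a} {xs : List A} → Unique xs →
                   ∀ i j → lookup xs i ≡ lookup xs j → i ≡ j
lookup-injective {xs = x ∷ xs} (x∉xs ∷ u) zero    zero    _  = refl
lookup-injective {xs = x ∷ xs} (x∉xs ∷ u) zero    (suc j) eq =
  contradiction eq (All.lookup x∉xs (∈-lookup j))
lookup-injective {xs = x ∷ xs} (x∉xs ∷ u) (suc i) zero    eq =
  contradiction (sym eq) (All.lookup x∉xs (∈-lookup i))
lookup-injective {xs = x ∷ xs} (x∉xs ∷ u) (suc i) (suc j) eq = cong suc (lookup-injective u i j eq)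

module _ {n : ℕ} where


  length≤n : ∀ {xs : List (Fin n)} → Unique xs → length xs ≤ n
  length≤n u = injective⇒≤ (lookup-injective u _ _)

  n≤length : ∀ {xs : List (Fin n)} → (∀ x → x ∈ xs) → n ≤ length xs
  n≤length {xs} complete = injective⇒≤ {f = Any.index ∘ complete} λ {x} {y} eq →
    trans (lookup-index (complete x)) (trans (cong (lookup xs) eq) (sym (lookup-index (complete y))))

firstIndex : ∀ {m p} {P : Pred (Fin m) p} → U.Decidable P → ℕ
firstIndex {zero}  _  = 0
firstIndex {suc m} P? with P? zero
... | yes _ = 0
... | no _  = suc (firstIndex (P? ∘ suc))

firstIndex-cong : ∀ {m p q} {P : Pred (Fin m) p} {Q : Pred (Fin m) q}
                  (P? : U.Decidable P) (Q? : U.Decidable Q) → (∀ {w} → P w → Q w) → (∀ {w} → Q w → P w) → firstIndex P? ≡ firstIndex Q?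
firstIndex-cong {zero}  _  _  _   _   = refl
firstIndex-cong {suc m} P? Q? P⇒Q Q⇒P with P? zero | Q? zero
... | yes _  | yes _  = refl
... | yes p  | no ¬q  = contradiction (P⇒Q p) ¬q
... | no ¬p  | yes q  = contradiction (Q⇒P q) ¬p
... | no _   | no _   = cong suc (firstIndex-cong (P? ∘ suc) (Q? ∘ suc) P⇒Q Q⇒P)

firstIndex-witness : ∀ {m p} {P : Pred (Fin m) p} (P? : U.Decidable P) {w} → P w →
                     ∃[ u ] P u × toℕ u ≡ firstIndex P?
firstIndex-witness {suc m} P? pw with P? zero
... | yes p₀ = zero , p₀ , refl
firstIndex-witness {suc m} P? {zero}  pw | no ¬p₀ = contradiction pw ¬p₀
firstIndex-witness {suc m} P? {suc w} pw | no ¬p₀ with firstIndex-witness (P? ∘ suc) pw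
... | u , pu , toℕu≡ = suc u , pu , cong suc toℕu≡

module _ {n ℓ} {_<_ : Rel (Fin n) ℓ} (wf : WellFounded _<_) (_<?_ : Decidable _<_) where

  least : ∀ {p} {P : Pred (Fin n) p} → U.Decidable P →
          ∀ {x} → P x → ∃[ m ] P m × (∀ w → P w → ¬ w < m)
  least {P = P} P? {x} px = descend px (wf x)
    where
      descend : ∀ {x} → P x → Acc _<_ x → ∃[ m ] P m × (∀ w → P w → ¬ w < m)
      descend {x} px (acc smaller) with any? (λ w → P? w ×-dec (w <? x))
      ... | yes (w , pw , w<x) = descend pw (smaller w<x)
      ... | no none            = x , px , λ w pw w<x → none (w , pw , w<x)

module _ {n : ℕ} {_≼_ : Rel (Fin n) 0ℓ} (isPO : IsDecPartialOrder _≡_ _≼_) where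

  open FinPoset _≼_ isPO
  open IsDecPartialOrder isPO using (_≤?_; _≟_; antisym; isPartialOrder)
    renaming (reflexive to ≼-reflexive; refl to ≼-refl; trans to ≼-trans)
  open DecMembership _≟_ using (_∈?_)

  ≺-irrefl : ∀ {x} → ¬ x ≺ x
  ≺-irrefl = ToStrict.<-irrefl _≡_ _≼_ refl

  ≺-trans : Transitive _≺_
  ≺-trans = ToStrict.<-trans _≡_ _≼_ isPartialOrder

  ≺-asym : ∀ {x y} → x ≺ y → ¬ y ≺ x
  ≺-asym = ToStrict.<-asym _≡_ _≼_ antisym

  _≺?_ : Decidable _≺_
  _≺?_ = ToStrict.<-decidable _≡_ _≼_ _≟_ _≤?_

  ≺⇒⋡ : ∀ {x y} → x ≺ y → ¬ y ≼ x
  ≺⇒⋡ = ToStrict.<⇒≱ _≡_ _≼_ antisym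

  ≼⇒≡⊎≺ : ∀ {x y} → x ≼ y → x ≡ y ⊎ x ≺ y
  ≼⇒≡⊎≺ {x} {y} x≼y with x ≟ y
  ... | yes x≡y = inj₁ x≡y
  ... | no x≢y  = inj₂ (x≼y , x≢y)

  Comparable : Rel (Fin n) 0ℓ
  Comparable x y = x ≼ y ⊎ y ≼ x

  _∥_ : Rel (Fin n) 0ℓ
  x ∥ y = ¬ Comparable x y

  comparable? : Decidable Comparable
  comparable? x y = (x ≤? y) ⊎-dec (y ≤? x)

  ∥-sym : ∀ {x y} → x ∥ y → y ∥ x
  ∥-sym x∥y = x∥y ∘ ⊎-swap

  bk-keep : ∀ {x y} r → Comparable x y → bk 0 (x ∷ y ∷ r) ≡ x ∷ y ∷ r
  bk-keep {x} {y} r c with x ≤? y | y ≤? x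
  ... | yes _  | _      = refl
  ... | no _   | yes _  = refl
  ... | no x⋠y | no y⋠x = contradiction c [ x⋠y , y⋠x ]′

  bk-swap : ∀ {x y} r → x ∥ y → bk 0 (x ∷ y ∷ r) ≡ y ∷ x ∷ r
  bk-swap {x} {y} r x∥y with x ≤? y | y ≤? x
  ... | yes x≼y | _       = contradiction (inj₁ x≼y) x∥y
  ... | no _    | yes y≼x = contradiction (inj₂ y≼x) x∥y
  ... | no _    | no _    = refl

  braidStep : ℕ → List (Fin n) → List (Fin n)
  braidStep i = bk i ∘ bk (suc i)

  braid : ℕ → List (Fin n) → List (Fin n)
  braid i = braidStep i ∘ braidStep i ∘ braidStep i

  braidStep-via : ∀ {a b c r M N} → bk 0 (b ∷ c ∷ r) ≡ M → bk 0 (a ∷ M) ≡ N →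
                  braidStep 0 (a ∷ b ∷ c ∷ r) ≡ N
  braidStep-via {a} p q = trans (cong (λ M → bk 0 (a ∷ M)) p) q

  braid-fixed : ∀ {L} → braidStep 0 L ≡ L → braid 0 L ≡ L
  braid-fixed p = trans (cong (braidStep 0 ∘ braidStep 0) p) (trans (cong (braidStep 0) p) p)

  braid-2cycle : ∀ {L M} → braidStep 0 L ≡ M → braidStep 0 M ≡ L → braid 0 L ≡ M
  braid-2cycle p q = trans (cong (braidStep 0 ∘ braidStep 0) p) (trans (cong (braidStep 0) q) p)

  braid-3cycle : ∀ {L M N} → braidStep 0 L ≡ M → braidStep 0 M ≡ N → braidStep 0 N ≡ L →
                 braid 0 L ≡ L
  braid-3cycle p q r = trans (cong (braidStep 0 ∘ braidStep 0) p) (trans (cong (braidStep 0) q) r)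

  braid-triple : Transitive Comparable → ∀ a b c r → braid 0 (a ∷ b ∷ c ∷ r) ≡ a ∷ b ∷ c ∷ r
  braid-triple trans~ a b c r with comparable? a b | comparable? b c | comparable? a c
  ... | yes a~b | yes b~c | _       = braid-fixed (braidStep-via (bk-keep r b~c) (bk-keep _ a~b))
  ... | yes a~b | no b∥c  | yes a~c = contradiction (trans~ (⊎-swap a~b) a~c) b∥c
  ... | no a∥b  | yes b~c | yes a~c = contradiction (trans~ a~c (⊎-swap b~c)) a∥b
  ... | yes a~b | no b∥c  | no a∥c  = braid-3cycle
        (braidStep-via (bk-swap r b∥c) (bk-swap _ a∥c))
        (braidStep-via (bk-keep r a~b) (bk-swap _ (∥-sym a∥c)))
        (braidStep-via (bk-swap r (∥-sym b∥c)) (bk-keep _ a~b))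
  ... | no a∥b  | yes b~c | no a∥c  = braid-3cycle
        (braidStep-via (bk-keep r b~c) (bk-swap _ a∥b))
        (braidStep-via (bk-swap r a∥c) (bk-keep _ b~c))
        (braidStep-via (bk-swap r (∥-sym a∥c)) (bk-swap _ (∥-sym a∥b)))
  ... | no a∥b  | no b∥c  | yes a~c = braid-3cycle
        (braidStep-via (bk-swap r b∥c) (bk-keep _ a~c))
        (braidStep-via (bk-swap r (∥-sym b∥c)) (bk-swap _ a∥b))
        (braidStep-via (bk-keep r a~c) (bk-swap _ (∥-sym a∥b)))
  ... | no a∥b  | no b∥c  | no a∥c  = braid-3cycle
        (braidStep-via (bk-swap r b∥c) (bk-swap _ a∥c))
        (braidStep-via (bk-swap r a∥b) (bk-swap _ (∥-sym b∥c)))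
        (braidStep-via (bk-swap r (∥-sym a∥c)) (bk-swap _ (∥-sym a∥b)))

  braid-holds : Transitive Comparable → ∀ i L → suc (suc i) < length L → braid i L ≡ L
  braid-holds trans~ zero    (a ∷ b ∷ c ∷ r) _               = braid-triple trans~ a b c r
  braid-holds trans~ zero    (_ ∷ [])        (s≤s ())
  braid-holds trans~ zero    (_ ∷ _ ∷ [])    (s≤s (s≤s ()))
  braid-holds trans~ (suc i) (x ∷ L)         (s≤s p)         = cong (x ∷_) (braid-holds trans~ i L p)

  braid-++ : ∀ pre r → braid (length pre) (pre ++ r) ≡ pre ++ braid 0 r
  braid-++ []        r = refl
  braid-++ (x ∷ pre) r = cong (x ∷_) (braid-++ pre r)

  braid-fails-V : ∀ {a b c} r → Comparable a b → Comparable a c → b ∥ c →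
                  braid 0 (a ∷ b ∷ c ∷ r) ≢ a ∷ b ∷ c ∷ r
  braid-fails-V {a} {b} {c} r a~b a~c b∥c fixed = b∥c (inj₂ (≼-reflexive c≡b))
    where
      cycle : braid 0 (a ∷ b ∷ c ∷ r) ≡ a ∷ c ∷ b ∷ r
      cycle = braid-2cycle (braidStep-via (bk-swap r b∥c) (bk-keep _ a~c))
                           (braidStep-via (bk-swap r (∥-sym b∥c)) (bk-keep _ a~b))
      c≡b : c ≡ b
      c≡b = ∷-injectiveˡ (∷-injectiveʳ (trans (sym cycle) fixed))

  braid-fails-Λ : ∀ {a b c} r → a ∥ b → Comparable a c → Comparable b c →
                  braid 0 (a ∷ b ∷ c ∷ r) ≢ a ∷ b ∷ c ∷ r
  braid-fails-Λ {a} {b} {c} r a∥b a~c b~c fixed = a∥b (inj₂ (≼-reflexive b≡a))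
    where
      cycle : braid 0 (a ∷ b ∷ c ∷ r) ≡ b ∷ a ∷ c ∷ r
      cycle = braid-2cycle (braidStep-via (bk-keep r b~c) (bk-swap _ a∥b))
                           (braidStep-via (bk-keep r a~c) (bk-swap _ (∥-sym a∥b)))
      b≡a : b ≡ a
      b≡a = ∷-injectiveˡ (trans (sym cycle) fixed)

  braid-suffix : AllBraidsHold → ∀ pre {a b c} post → IsLinearExtension (pre ++ a ∷ b ∷ c ∷ post) →
             braid 0 (a ∷ b ∷ c ∷ post) ≡ a ∷ b ∷ c ∷ post
  braid-suffix braids pre post L∈ℒ = ++-cancelˡ pre _ _ (trans (sym (braid-++ pre _))
    (braids (length pre) (ℕ.<-≤-trans (index<length pre) (length≤n (proj₁ L∈ℒ))) _ L∈ℒ))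
    where
      index<length : ∀ pre {a b c post} → suc (suc (length pre)) < length (pre ++ a ∷ b ∷ c ∷ post)
      index<length []        = s≤s (s≤s (s≤s z≤n))
      index<length (_ ∷ pre) = s≤s (index<length pre)

  rank : Fin n → ℕ
  rank v = length (filter (_≺? v) (allFin n))

  rank-mono : ∀ {x y} → x ≺ y → rank x < rank y
  rank-mono {x} x≺y = length-filter-strict (_≺? x) (_≺? _) (λ w≺x → ≺-trans w≺x x≺y)
                        (allFin n) (∈-allFin x) ≺-irrefl x≺y

  private
    module ByRank = Sort (On.decTotalOrder ℕ.≤-decTotalOrder rank)

  sortByRank : List (Fin n) → List (Fin n)
  sortByRank = ByRank.sort

  ∈-sortByRank : ∀ {x xs} → x ∈ xs → x ∈ sortByRank xs
  ∈-sortByRank {xs = xs} = ∈-resp-↭ (↭-sym (ByRank.sort-↭ xs))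

  MayPrecede : Rel (Fin n) 0ℓ
  MayPrecede v w = v ≢ w × ¬ w ≺ v

  Compatible : List (Fin n) → Set
  Compatible = AllPairs MayPrecede

  compatible-sortByRank : ∀ {xs} → Unique xs → Compatible (sortByRank xs)
  compatible-sortByRank {xs} u = AllPairs.zipWith
    (λ (v≢w , rv≤rw) → v≢w , λ w≺v → ℕ.<⇒≱ (rank-mono w≺v) rv≤rw)
    ( PermutationSetoid.Unique-resp-↭ (setoid (Fin n)) (↭⇒↭ₛ (↭-sym (ByRank.sort-↭ xs))) u
    , Linked⇒AllPairs ℕ.≤-trans (ByRank.sort-↗ xs))

  All-sortByRank : ∀ {P : Pred (Fin n) 0ℓ} {xs} → All P xs → All P (sortByRank xs)
  All-sortByRank {xs = xs} = All-resp-↭ (↭-sym (ByRank.sort-↭ xs))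

  DownClosed : Pred (Fin n) 0ℓ → Set
  DownClosed S = ∀ {v w} → v ≺ w → S w → S v

  compatible-++ : ∀ {S xs ys} → DownClosed S → All S xs → All (∁ S) ys →
                  Compatible xs → Compatible ys → Compatible (xs ++ ys)
  compatible-++ down Sxs ¬Sys cxs cys = AllPairsₚ.++⁺ cxs cys
    (All.map (λ Sv → All.map (λ ¬Sw → (λ { refl → ¬Sw Sv }) , λ w≺v → ¬Sw (down w≺v Sv)) ¬Sys) Sxs)

  precedes : ∀ {L} → Compatible L → ∀ a b → lookup L a ≺ lookup L b → a F.< b
  precedes {x ∷ L} _        zero    zero    x≺x = contradiction x≺x ≺-irrefl
  precedes {x ∷ L} _        zero    (suc b) _   = s≤s z≤n
  precedes {x ∷ L} (mp ∷ _) (suc a) zero    p   = contradiction p (proj₂ (All.lookup mp (∈-lookup a)))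
  precedes {x ∷ L} (_ ∷ c)  (suc a) (suc b) p   = s≤s (precedes c a b p)

  compatible⇒linearExtension : ∀ {L} → Compatible L → (∀ x → x ∈ L) → IsLinearExtension L
  compatible⇒linearExtension c complete = AllPairs.map proj₁ c , complete , precedes c

  module _ {D : Pred (Fin n) 0ℓ} (D? : U.Decidable D) (mid : List (Fin n)) where

    private
      Rest : Pred (Fin n) 0ℓ
      Rest = ∁ (D ∪ (_∈ mid))

      Rest? : U.Decidable Rest
      Rest? v = ¬? (D? v ⊎-dec (v ∈? mid))

      sorted : ∀ {P : Pred (Fin n) 0ℓ} → U.Decidable P → List (Fin n)
      sorted P? = sortByRank (filter P? (allFin n))

      sorted-compatible : ∀ {P : Pred (Fin n) 0ℓ} (P? : U.Decidable P) → Compatible (sorted P?)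
      sorted-compatible P? = compatible-sortByRank (Unique.filter⁺ P? (Unique.allFin⁺ n))

      sorted-All : ∀ {P : Pred (Fin n) 0ℓ} (P? : U.Decidable P) → All P (sorted P?)
      sorted-All P? = All-sortByRank (all-filter P? (allFin n))

      ∈-sorted : ∀ {P : Pred (Fin n) 0ℓ} (P? : U.Decidable P) {x} → P x → x ∈ sorted P?
      ∈-sorted P? px = ∈-sortByRank (∈-filter⁺ P? (∈-allFin _) px)

    below above : List (Fin n)
    below = sorted D?
    above = sorted Rest?

    linearExtension-through : DownClosed D → DownClosed (D ∪ (_∈ mid)) → All (∁ D) mid →
                              Compatible mid → IsLinearExtension (below ++ mid ++ above)
    linearExtension-through downD downDmid ¬Dmid cmid = compatible⇒linearExtension
      (compatible-++ downD (sorted-All D?) (All-++⁺ ¬Dmid (All.map (_∘ inj₁) (sorted-All Rest?)))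
        (sorted-compatible D?)
        (compatible-++ downDmid (All.tabulate inj₂) (sorted-All Rest?) cmid (sorted-compatible Rest?)))
      complete
      where
        complete : ∀ x → x ∈ below ++ mid ++ above
        complete x with D? x | x ∈? mid
        ... | yes d | _     = ∈-++⁺ˡ (∈-sorted D? d)
        ... | no _  | yes m = ∈-++⁺ʳ below (∈-++⁺ˡ m)
        ... | no ¬d | no ¬m = ∈-++⁺ʳ below (∈-++⁺ʳ mid (∈-sorted Rest? [ ¬d , ¬m ]′))

  minimal : ∀ {P : Pred (Fin n) 0ℓ} → U.Decidable P →
            ∀ {x} → P x → ∃[ m ] P m × (∀ w → P w → ¬ w ≺ m)
  minimal = least (po-wellFounded isPartialOrder) _≺?_

  maximal : ∀ {P : Pred (Fin n) 0ℓ} → U.Decidable P →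
            ∀ {x} → P x → ∃[ m ] P m × (∀ w → P w → ¬ m ≺ w)
  maximal = least (po-noetherian isPartialOrder) (flip _≺?_)

  _⋖_ : Rel (Fin n) 0ℓ
  x ⋖ y = x ≺ y × ∀ w → x ≺ w → ¬ w ≺ y

  upper-cover-below : ∀ {b x} → b ≺ x → ∃[ c ] b ⋖ c × c ≼ x
  upper-cover-below {b} {x} b≺x with minimal (λ w → (b ≺? w) ×-dec (w ≤? x)) (b≺x , ≼-refl)
  ... | c , (b≺c , c≼x) , least-c =
    c , (b≺c , λ w b≺w w≺c → least-c w (b≺w , ≼-trans (proj₁ w≺c) c≼x) w≺c) , c≼x

  lower-cover-above : ∀ {x t} → x ≺ t → ∃[ c ] x ≼ c × c ⋖ t
  lower-cover-above {x} {t} x≺t with maximal (λ w → (x ≤? w) ×-dec (w ≺? t)) (≼-refl , x≺t)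
  ... | c , (x≼c , c≺t) , greatest-c =
    c , x≼c , (c≺t , λ w c≺w w≺t → greatest-c w (≼-trans x≼c (proj₁ c≺w) , w≺t) c≺w)

  record CoveredV : Set where
    field
      {bottom left right} : Fin n
      bottom⋖left         : bottom ⋖ left
      bottom⋖right        : bottom ⋖ right
      left∥right          : left ∥ right

  record CoveredΛ : Set where
    field
      {left right top} : Fin n
      left⋖top         : left ⋖ top
      right⋖top        : right ⋖ top
      left∥right       : left ∥ right

  coveredV : ∀ {y x z} → y ≺ x → y ≺ z → x ∥ z → CoveredV
  coveredV {y} {x} {z} y≺x y≺z x∥z with maximal (λ w → (w ≺? x) ×-dec (w ≺? z)) (y≺x , y≺z)
  ... | b , (b≺x , b≺z) , greatest-b with upper-cover-below b≺x | upper-cover-below b≺z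
  ... | x′ , b⋖x′ , x′≼x | z′ , b⋖z′ , z′≼z = record
    { bottom⋖left = b⋖x′ ; bottom⋖right = b⋖z′ ; left∥right = x′∥z′ }
    where
      no-bound-above-b : ∀ {w} → b ≺ w → w ≼ x → w ≼ z → ⊥
      no-bound-above-b {w} b≺w w≼x w≼z =
        greatest-b w ((w≼x , λ { refl → x∥z (inj₁ w≼z) }) , (w≼z , λ { refl → x∥z (inj₂ w≼x) })) b≺w
      x′∥z′ : x′ ∥ z′
      x′∥z′ (inj₁ x′≼z′) = no-bound-above-b (proj₁ b⋖x′) x′≼x (≼-trans x′≼z′ z′≼z)
      x′∥z′ (inj₂ z′≼x′) = no-bound-above-b (proj₁ b⋖z′) (≼-trans z′≼x′ x′≼x) z′≼z

  coveredΛ : ∀ {x z y} → x ≺ y → z ≺ y → x ∥ z → CoveredΛ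
  coveredΛ {x} {z} {y} x≺y z≺y x∥z with minimal (λ w → (x ≺? w) ×-dec (z ≺? w)) (x≺y , z≺y)
  ... | t , (x≺t , z≺t) , least-t with lower-cover-above x≺t | lower-cover-above z≺t
  ... | x′ , x≼x′ , x′⋖t | z′ , z≼z′ , z′⋖t = record
    { left⋖top = x′⋖t ; right⋖top = z′⋖t ; left∥right = x′∥z′ }
    where
      no-bound-below-t : ∀ {w} → x ≼ w → z ≼ w → w ≺ t → ⊥
      no-bound-below-t {w} x≼w z≼w w≺t =
        least-t w ((x≼w , λ { refl → x∥z (inj₂ z≼w) }) , (z≼w , λ { refl → x∥z (inj₁ x≼w) })) w≺t
      x′∥z′ : x′ ∥ z′
      x′∥z′ (inj₁ x′≼z′) = no-bound-below-t (≼-trans x≼x′ x′≼z′) z≼z′ (proj₁ z′⋖t)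
      x′∥z′ (inj₂ z′≼x′) = no-bound-below-t x≼x′ (≼-trans z≼z′ z′≼x′) (proj₁ x′⋖t)

  ¬coveredV : AllBraidsHold → ¬ CoveredV
  ¬coveredV braids record { bottom = b ; left = x ; right = z
                          ; bottom⋖left = b≺x , b⋖x ; bottom⋖right = b≺z , b⋖z ; left∥right = x∥z } =
    braid-fails-V (above D? mid) (inj₁ (proj₁ b≺x)) (inj₁ (proj₁ b≺z)) x∥z
      (braid-suffix braids (below D? mid) (above D? mid)
        (linearExtension-through D? mid downD downDmid ¬Dmid compatible-mid))
    where
      mid : List (Fin n)
      mid = b ∷ x ∷ z ∷ []

      D : Pred (Fin n) 0ℓ
      D v = (v ≺ x ⊎ v ≺ z) × v ≢ b

      D? : U.Decidable D
      D? v = ((v ≺? x) ⊎-dec (v ≺? z)) ×-dec ¬? (v ≟ b)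

      downD : DownClosed D
      downD v≺w (inj₁ w≺x , _) = inj₁ (≺-trans v≺w w≺x) , λ { refl → b⋖x _ v≺w w≺x }
      downD v≺w (inj₂ w≺z , _) = inj₂ (≺-trans v≺w w≺z) , λ { refl → b⋖z _ v≺w w≺z }

      downDmid : DownClosed (D ∪ (_∈ mid))
      downDmid v≺w (inj₁ Dw)          = inj₁ (downD v≺w Dw)
      downDmid v≺b (inj₂ (here refl)) = inj₁ (inj₁ (≺-trans v≺b b≺x) , λ { refl → ≺-irrefl v≺b })
      downDmid {v} v≺x (inj₂ (there (here refl))) with v ≟ b
      ... | yes v≡b = inj₂ (here v≡b)
      ... | no v≢b  = inj₁ (inj₁ v≺x , v≢b)
      downDmid {v} v≺z (inj₂ (there (there (here refl)))) with v ≟ b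
      ... | yes v≡b = inj₂ (here v≡b)
      ... | no v≢b  = inj₁ (inj₂ v≺z , v≢b)

      ¬Dmid : All (∁ D) mid
      ¬Dmid = (λ (_ , b≢b) → b≢b refl)
            ∷ [ ≺-irrefl , x∥z ∘ inj₁ ∘ proj₁ ]′ ∘ proj₁
            ∷ [ x∥z ∘ inj₂ ∘ proj₁ , ≺-irrefl ]′ ∘ proj₁
            ∷ []

      compatible-mid : Compatible mid
      compatible-mid = ((proj₂ b≺x , ≺-asym b≺x) ∷ (proj₂ b≺z , ≺-asym b≺z) ∷ [])
                     ∷ (((λ { refl → x∥z (inj₁ ≼-refl) }) , x∥z ∘ inj₂ ∘ proj₁) ∷ [])
                     ∷ [] ∷ []

  ¬coveredΛ : AllBraidsHold → ¬ CoveredΛ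
  ¬coveredΛ braids record { left = x ; right = z ; top = t
                          ; left⋖top = x≺t , x⋖t ; right⋖top = z≺t , z⋖t ; left∥right = x∥z } =
    braid-fails-Λ (above D? mid) x∥z (inj₁ (proj₁ x≺t)) (inj₁ (proj₁ z≺t))
      (braid-suffix braids (below D? mid) (above D? mid)
        (linearExtension-through D? mid downD downDmid ¬Dmid compatible-mid))
    where
      mid : List (Fin n)
      mid = x ∷ z ∷ t ∷ []

      D : Pred (Fin n) 0ℓ
      D v = ¬ x ≼ v × ¬ z ≼ v

      D? : U.Decidable D
      D? v = ¬? (x ≤? v) ×-dec ¬? (z ≤? v)

      downD : DownClosed D
      downD v≺w (x⋠w , z⋠w) =
        (λ x≼v → x⋠w (≼-trans x≼v (proj₁ v≺w))) , (λ z≼v → z⋠w (≼-trans z≼v (proj₁ v≺w)))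

      downDmid : DownClosed (D ∪ (_∈ mid))
      downDmid v≺w (inj₁ Dw) = inj₁ (downD v≺w Dw)
      downDmid v≺x (inj₂ (here refl)) =
        inj₁ (≺⇒⋡ v≺x , λ z≼v → x∥z (inj₂ (≼-trans z≼v (proj₁ v≺x))))
      downDmid v≺z (inj₂ (there (here refl))) =
        inj₁ ((λ x≼v → x∥z (inj₁ (≼-trans x≼v (proj₁ v≺z)))) , ≺⇒⋡ v≺z)
      downDmid {v} v≺t (inj₂ (there (there (here refl)))) with x ≤? v | z ≤? v
      ... | yes x≼v | _       =
        [ (λ x≡v → inj₂ (here (sym x≡v))) , (λ x≺v → contradiction v≺t (x⋖t v x≺v)) ]′ (≼⇒≡⊎≺ x≼v)
      ... | no _    | yes z≼v =
        [ (λ z≡v → inj₂ (there (here (sym z≡v)))) , (λ z≺v → contradiction v≺t (z⋖t v z≺v)) ]′ (≼⇒≡⊎≺ z≼v)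
      ... | no x⋠v  | no z⋠v  = inj₁ (x⋠v , z⋠v)

      ¬Dmid : All (∁ D) mid
      ¬Dmid = (λ (x⋠x , _) → x⋠x ≼-refl)
            ∷ (λ (_ , z⋠z) → z⋠z ≼-refl)
            ∷ (λ (x⋠t , _) → x⋠t (proj₁ x≺t))
            ∷ []

      compatible-mid : Compatible mid
      compatible-mid = (((λ { refl → x∥z (inj₁ ≼-refl) }) , x∥z ∘ inj₂ ∘ proj₁)
                         ∷ (proj₂ x≺t , ≺-asym x≺t) ∷ [])
                     ∷ ((proj₂ z≺t , ≺-asym z≺t) ∷ [])
                     ∷ [] ∷ []

  braids⇒transitive : AllBraidsHold → Transitive Comparable
  braids⇒transitive braids {x} {y} {z} x~y y~z with comparable? x z
  ... | yes x~z = x~z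
  ... | no x∥z with x~y | y~z
  ... | inj₁ x≼y | inj₁ y≼z = contradiction (inj₁ (≼-trans x≼y y≼z)) x∥z
  ... | inj₂ y≼x | inj₂ z≼y = contradiction (inj₂ (≼-trans z≼y y≼x)) x∥z
  ... | inj₂ y≼x | inj₁ y≼z = contradiction
        (coveredV (y≼x , λ { refl → x∥z (inj₁ y≼z) }) (y≼z , λ { refl → x∥z (inj₂ y≼x) }) x∥z)
        (¬coveredV braids)
  ... | inj₁ x≼y | inj₂ z≼y = contradiction
        (coveredΛ (x≼y , λ { refl → x∥z (inj₂ z≼y) }) (z≼y , λ { refl → x∥z (inj₁ x≼y) }) x∥z)
        (¬coveredΛ braids)

  transitive⇒braids : Transitive Comparable → AllBraidsHold
  transitive⇒braids trans~ i i+2<n L (_ , complete , _) =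
    braid-holds trans~ i L (ℕ.<-≤-trans i+2<n (n≤length complete))

  transitive⇒chains : Transitive Comparable → IsDisjointUnionOfChains
  transitive⇒chains trans~ = label , same-label , comparable-of-label
    where
      label : Fin n → ℕ
      label x = firstIndex (comparable? x)

      same-label : ∀ x y → x ≼ y → label x ≡ label y
      same-label x y x≼y = firstIndex-cong (comparable? x) (comparable? y)
        (trans~ (inj₂ x≼y)) (trans~ (inj₁ x≼y))

      comparable-of-label : ∀ x y → label x ≡ label y → Comparable x y
      comparable-of-label x y eq
        with firstIndex-witness (comparable? x) (inj₁ ≼-refl)
           | firstIndex-witness (comparable? y) (inj₁ ≼-refl)
      ... | u , x~u , u≡ | v , y~v , v≡ rewrite toℕ-injective (trans u≡ (trans eq (sym v≡))) =
        trans~ x~u (⊎-swap y~v)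

  chains⇒transitive : IsDisjointUnionOfChains → Transitive Comparable
  chains⇒transitive (label , same-label , comparable-of-label) {x} {_} {z} x~y y~z =
    comparable-of-label x z (trans (label-cong x~y) (label-cong y~z))
    where
      label-cong : ∀ {x y} → Comparable x y → label x ≡ label y
      label-cong (inj₁ x≼y) = same-label _ _ x≼y
      label-cong (inj₂ y≼x) = sym (same-label _ _ y≼x)

proposition3p8 : (n : ℕ) (_≼_ : Fin n → Fin n → Set) (isPO : IsDecPartialOrder _≡_ _≼_) →
    FinPoset.AllBraidsHold _≼_ isPO ⇔ FinPoset.IsDisjointUnionOfChains _≼_ isPO
proposition3p8 n _≼_ isPO = mk⇔
  (transitive⇒chains isPO ∘ braids⇒transitive isPO)
  (transitive⇒braids isPO ∘ chains⇒transitive isPO)
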